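{- Let $\sharp:\Re\to U(\mathfrak{sl}_2)$ be the algebra homomorphism described in the context. Then \[ \sharp(\Omega_A)=\sharp(\Omega_B)=\sharp(\Omega_C)=-\frac{3}{1024}(\Lambda-4)(\Lambda-12). \]
   Context: All algebras are unital associative over $\mathbb C$, $[x,y]=xy-yx$, $\mathbf i=\sqrt{ -1}$. $U(\mathfrak{sl}_2)$ is the algebra generated by $E,F,H$ subject to $[H,E]=2E$, $[H,F]=-2F$, $[E,F]=H$; $\Lambda=EF+FE+\frac{H^2}{2}$. The universal Racah algebra $\Re$ is generated by $A,B,C,\Delta$ subject to $[A,B]=[B,C]=[C,A]=2\Delta$ and the requirement that each of $\alpha=[A,\Delta]+AC-BA$, $\beta=[B,\Delta]+BA-CB$, $\gamma=[C,\Delta]+CB-AC$ is central; also $\delta=A+B+C$ is central. Define \[ \Omega_A=\Delta^2+\tfrac{BAC+CAB}{2}+A^2+B\gamma-C\beta-A\delta,\quad \Omega_B=\Delta^2+\tfrac{CBA+ABC}{2}+B^2+C\alpha-A\gamma-B\delta, \] \[ \Omega_C=\Delta^2+\tfrac{ACB+BCA}{2}+C^2+A\beta-B\alpha-C\delta. \] $\sharp:\Re\to U(\mathfrak{sl}_2)$ is the algebra homomorphism with $A\mapsto \frac{(E+F-2)(E+F+2)}{16}$, $B\mapsto\frac{(H-2)(H+2)}{16}$, $C\mapsto \frac{(\mathbf iE-\mathbf iF-2)(\mathbf iE-\mathbf iF+2)}{16}$, $\Delta\mapsto\frac{(H+2)F^2-(H-2)E^2}{64}$ (such a homomorphism exists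 and is unique). -}

module Defs where

open import Level using (_⊔_; suc)
open import Algebra.Bundles using (Ring)
open import Data.Product using (_×_)

module InRing {c ℓ} (R : Ring c ℓ) where
  open Ring R

  infixl 6 _⊖_
  _⊖_ : Carrier → Carrier → Carrier
  x ⊖ y = x + (- y)

  [_,_] : Carrier → Carrier → Carrier
  [ x , y ] = x * y ⊖ y * x

  two three four twelve : Carrier
  two = 1# + 1#
  three = two + 1#
  four = two + two
  twelve = four + four + four

  record Sl2Data (i h E F H : Carrier) : Set (c ⊔ ℓ) where
    field
      i-central : ∀ x → i * x ≈ x * i
      i²        : i * i ≈ - 1#
      h-half    : two * h ≈ 1#
      HE        : [ H , E ] ≈ two * E
      HF        : [ H , F ] ≈ - (two * F)
      EF        : [ E , F ] ≈ H

  -- Racah-algebra expressions evaluated at arbitrary a b c' d (images of A,B,C,Δ),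
  -- with h playing the role of 1/2.
  module Racah (h a b c' d : Carrier) where
    α β γ δ : Carrier
    α = [ a , d ] + a * c' ⊖ b * a
    β = [ b , d ] + b * a ⊖ c' * b
    γ = [ c' , d ] + c' * b ⊖ a * c'
    δ = a + b + c'

    ΩA ΩB ΩC : Carrier
    ΩA = d * d + h * (b * a * c' + c' * a * b) + a * a + b * γ ⊖ c' * β ⊖ a * δ
    ΩB = d * d + h * (c' * b * a + a * b * c') + b * b + c' * α ⊖ a * γ ⊖ b * δ
    ΩC = d * d + h * (a * c' * b + b * c' * a) + c' * c' + a * β ⊖ b * α ⊖ c' * δ

  module Sharp (i h E F H : Carrier) where
    h⁴ h⁶ h¹⁰ : Carrier
    h⁴ = h * h * h * h
    h⁶ = h⁴ * h * h
    h¹⁰ = h⁶ * h⁴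

    ♯A ♯B ♯C ♯Δ : Carrier
    ♯A = h⁴ * ((E + F ⊖ two) * (E + F + two))
    ♯B = h⁴ * ((H ⊖ two) * (H + two))
    ♯C = h⁴ * ((i * E ⊖ i * F ⊖ two) * (i * E ⊖ i * F + two))
    ♯Δ = h⁶ * ((H + two) * F * F ⊖ (H ⊖ two) * E * E)

    Λ : Carrier
    Λ = E * F + F * E + h * (H * H)

    open Racah h ♯A ♯B ♯C ♯Δ public

    target : Carrier
    target = - (three * h¹⁰) * ((Λ ⊖ four) * (Λ ⊖ twelve))

    Claim : Set ℓ
    Claim = (ΩA ≈ ΩB) × (ΩB ≈ ΩC) × (ΩC ≈ target)

{-# OPTIONS --safe #-}

-- Both sides are noncommutative polynomials in i, F, H, E and ½, so the identities are decided by
-- normal ordering: every ring expression is rewritten into a linear combination of words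
-- i^ε F^a H^b E^c with dyadic coefficients, using only the relations of U(sl₂), i² = -1 with i
-- central, and 2 · ½ = 1 (which forces ½ to be central). The rewriting is sound in every ring
-- satisfying these relations, and for each of the three differences of the two sides the normal
-- form is the empty sum.

module Submission where

open import Defs
open import Algebra.Bundles using (Ring; RawRing)
import Algebra.Morphism.RingMonomorphism as RingMonomorphism
open import Algebra.Morphism.Structures using (IsRingMonomorphism)
open import Data.Fin using (Fin; zero; suc)
import Data.Fin.Properties as Fin
open import Data.List using (List; []; _∷_; map)
import Data.List.Properties as List
open import Data.Nat as ℕ using (ℕ; zero; suc; _⊔_; _∸_; _≤_)
open import Data.Nat.Properties using (m≤m⊔n; m≤n⊔m; m+[n∸m]≡n)
open import Data.Product using (_×_; _,_; map₁; map₂)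
open import Data.Vec using (Vec; []; _∷_; lookup)
open import Function using (id; _on_)
import Level
open import Relation.Binary.Definitions using (DecidableEquality)
import Relation.Binary.PropositionalEquality as ≡
open import Relation.Nullary using (Dec; yes; no)

module Dyadic where
  infix 5 _⊖_/2^_
  record Dyadic : Set where
    constructor _⊖_/2^_
    field
      numerator⁺ numerator⁻ exponent : ℕ
  open Dyadic public

  one two half : Dyadic
  one = 1 ⊖ 0 /2^ 0
  two = 2 ⊖ 0 /2^ 0
  half = 1 ⊖ 0 /2^ 1

  infix 8 -_
  -_ : Dyadic → Dyadic
  - (p ⊖ q /2^ k) = q ⊖ p /2^ k

  rescale : ℕ → Dyadic → Dyadic
  rescale m (p ⊖ q /2^ k) = p ℕ.* 2 ℕ.^ (m ∸ k) ⊖ q ℕ.* 2 ℕ.^ (m ∸ k) /2^ m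

  infixl 6 _+_
  _+_ : Dyadic → Dyadic → Dyadic
  d + e = numerator⁺ d′ ℕ.+ numerator⁺ e′ ⊖ numerator⁻ d′ ℕ.+ numerator⁻ e′ /2^ m
    where
      m = exponent d ⊔ exponent e
      d′ = rescale m d
      e′ = rescale m e

  infixl 7 _*_
  _*_ : Dyadic → Dyadic → Dyadic
  (p ⊖ q /2^ k) * (p′ ⊖ q′ /2^ k′) = p ℕ.* p′ ℕ.+ q ℕ.* q′ ⊖ p ℕ.* q′ ℕ.+ q ℕ.* p′ /2^ (k ℕ.+ k′)

  IsZero : Dyadic → Set
  IsZero d = numerator⁺ d ≡.≡ numerator⁻ d

  isZero? : ∀ d → Dec (IsZero d)
  isZero? d = numerator⁺ d ℕ.≟ numerator⁻ d

open Dyadic using (Dyadic; _⊖_/2^_)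

infixl 6 _+ₑ_
infixl 7 _*ₑ_
infix 8 -ₑ_
data Expr (n : ℕ) : Set where
  var : Fin n → Expr n
  0ₑ 1ₑ ½ₑ : Expr n
  _+ₑ_ _*ₑ_ : Expr n → Expr n → Expr n
  -ₑ_ : Expr n → Expr n

module Polynomials (n : ℕ) where
  Word : Set
  Word = List (Fin n)

  Term : Set
  Term = Dyadic × Word

  Poly : Set
  Poly = List Term

  _≟ʷ_ : DecidableEquality Word
  _≟ʷ_ = List.≡-dec Fin._≟_

  insert : Term → Poly → Poly
  insert t [] = t ∷ []
  insert (d , w) ((e , v) ∷ p) with w ≟ʷ v | Dyadic.isZero? (d Dyadic.+ e)
  ... | yes _ | yes _ = p
  ... | yes _ | no _  = (d Dyadic.+ e , v) ∷ p
  ... | no _  | _     = (e , v) ∷ insert (d , w) p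

  infixl 6 _⊕_
  _⊕_ : Poly → Poly → Poly
  [] ⊕ q = q
  (t ∷ p) ⊕ q = insert t (p ⊕ q)

  infixr 7 _⊙_ _◃_
  _⊙_ : Dyadic → Poly → Poly
  d ⊙ p = map (map₁ (d Dyadic.*_)) p

  _◃_ : Fin n → Poly → Poly
  g ◃ p = map (map₂ (g ∷_)) p

  ⟨_⟩ : Word → Poly
  ⟨ w ⟩ = (Dyadic.one , w) ∷ []

  linear : (Word → Poly) → Poly → Poly
  linear f [] = []
  linear f ((d , w) ∷ p) = d ⊙ f w ⊕ linear f p

  module Normalise (_·_ : Fin n → Word → Poly) where
    infixr 7 _⊗ʷ_
    _⊗ʷ_ : Word → Poly → Poly
    [] ⊗ʷ p = p
    (g ∷ w) ⊗ʷ p = linear (g ·_) (w ⊗ʷ p)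

    infixl 7 _⊗_
    _⊗_ : Poly → Poly → Poly
    [] ⊗ q = []
    ((d , w) ∷ p) ⊗ q = d ⊙ w ⊗ʷ q ⊕ p ⊗ q

    nf : Expr n → Poly
    nf (var g) = ⟨ g ∷ [] ⟩
    nf 0ₑ = []
    nf 1ₑ = ⟨ [] ⟩
    nf ½ₑ = (Dyadic.half , []) ∷ []
    nf (a +ₑ b) = nf a ⊕ nf b
    nf (a *ₑ b) = nf a ⊗ nf b
    nf (-ₑ a) = Dyadic.- Dyadic.one ⊙ nf a

pattern 𝐢 = zero
pattern 𝐅 = suc zero
pattern 𝐇 = suc (suc zero)
pattern 𝐄 = suc (suc (suc zero))

module Sl2 where
  open Polynomials 4

  -- Left multiplication of a word in normal order 𝐢^ε 𝐅^a 𝐇^b 𝐄^c by a generator, using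
  -- i² = -1, EF = FE + H, HF = FH - 2F, EH = HE - 2E and that i is central.
  infixr 7 𝐢·_ 𝐅·_ 𝐇·_ 𝐄·_
  𝐢·_ 𝐅·_ 𝐇·_ 𝐄·_ : Word → Poly
  𝐢· (𝐢 ∷ w) = Dyadic.- Dyadic.one ⊙ ⟨ w ⟩
  𝐢· w = ⟨ 𝐢 ∷ w ⟩

  𝐅· (𝐢 ∷ w) = 𝐢 ◃ 𝐅· w
  𝐅· w = ⟨ 𝐅 ∷ w ⟩

  𝐇· (𝐢 ∷ w) = 𝐢 ◃ 𝐇· w
  𝐇· (𝐅 ∷ w) = 𝐅 ◃ 𝐇· w ⊕ Dyadic.- Dyadic.two ⊙ ⟨ 𝐅 ∷ w ⟩
  𝐇· w = ⟨ 𝐇 ∷ w ⟩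

  𝐄· (𝐢 ∷ w) = 𝐢 ◃ 𝐄· w
  𝐄· (𝐅 ∷ w) = 𝐅 ◃ 𝐄· w ⊕ 𝐇· w
  𝐄· (𝐇 ∷ w) = linear 𝐇·_ (𝐄· w) ⊕ Dyadic.- Dyadic.two ⊙ 𝐄· w
  𝐄· w = ⟨ 𝐄 ∷ w ⟩

  _·_ : Fin 4 → Word → Poly
  𝐢 · w = 𝐢· w
  𝐅 · w = 𝐅· w
  𝐇 · w = 𝐇· w
  𝐄 · w = 𝐄· w

module Semantics {c ℓ} (R : Ring c ℓ) where
  open Ring R
  open InRing R using (two; [_,_])
  open import Algebra.Properties.Ring R using (-‿distribˡ-*; -‿distribʳ-*; x[y-z]≈xy-xz; [y-z]x≈yx-zx; -1*x≈-x)
  open import Algebra.Properties.AbelianGroup +-abelianGroup using (⁻¹-anti-homo‿-; ⁻¹-∙-comm)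
  open import Algebra.Properties.CommutativeSemigroup +-commutativeSemigroup using (interchange; x∙yz≈y∙xz)
  open import Algebra.Properties.Group +-group using (ε⁻¹≈ε; //-rightDividesˡ; //-rightDividesʳ; x∙y⁻¹≈ε⇒x≈y)
  open import Algebra.Properties.Semiring.Mult semiring
    using (×-homo-+; ×1-homo-*; ×-assoc-*; ×-comm-*; ×-congʳ) renaming (_×_ to _×ᵣ_)
  open import Algebra.Properties.Semiring.Exp semiring using (_^_; ^-homo-*; ^-congʳ)
  open import Relation.Binary.Reasoning.Setoid setoid


  Central : Carrier → Set (c Level.⊔ ℓ)
  Central a = ∀ x → a * x ≈ x * a

  1#-central : Central 1#
  1#-central x = trans (*-identityˡ x) (sym (*-identityʳ x))

  +-central : ∀ {a b} → Central a → Central b → Central (a + b)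
  +-central {a} {b} ca cb x = begin
    (a + b) * x     ≈⟨ distribʳ x a b ⟩
    a * x + b * x   ≈⟨ +-cong (ca x) (cb x) ⟩
    x * a + x * b   ≈⟨ distribˡ x a b ⟨
    x * (a + b)     ∎

  -‿central : ∀ {a} → Central a → Central (- a)
  -‿central {a} ca x = begin
    - a * x     ≈⟨ -‿distribˡ-* a x ⟨
    - (a * x)   ≈⟨ -‿cong (ca x) ⟩
    - (x * a)   ≈⟨ -‿distribʳ-* x a ⟩
    x * - a     ∎

  *-central : ∀ {a b} → Central a → Central b → Central (a * b)
  *-central {a} {b} ca cb x = begin
    (a * b) * x   ≈⟨ *-assoc a b x ⟩
    a * (b * x)   ≈⟨ *-congˡ (cb x) ⟩
    a * (x * b)   ≈⟨ *-assoc a x b ⟨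
    (a * x) * b   ≈⟨ *-congʳ (ca x) ⟩
    (x * a) * b   ≈⟨ *-assoc x a b ⟩
    x * (a * b)   ∎

  central-inverse : ∀ {a b} → Central a → a * b ≈ 1# → Central b
  central-inverse {a} {b} ca ab≈1 x = begin
    b * x               ≈⟨ *-identityʳ (b * x) ⟨
    (b * x) * 1#        ≈⟨ *-congˡ ab≈1 ⟨
    (b * x) * (a * b)   ≈⟨ *-assoc b x (a * b) ⟩
    b * (x * (a * b))   ≈⟨ *-congˡ (*-assoc x a b) ⟨
    b * ((x * a) * b)   ≈⟨ *-congˡ (*-congʳ (ca x)) ⟨
    b * ((a * x) * b)   ≈⟨ *-congˡ (*-assoc a x b) ⟩
    b * (a * (x * b))   ≈⟨ *-assoc b a (x * b) ⟨
    (b * a) * (x * b)   ≈⟨ *-congʳ (trans (sym (ca b)) ab≈1) ⟩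
    1# * (x * b)        ≈⟨ *-identityˡ (x * b) ⟩
    x * b               ∎

  central-swap : ∀ {a} → Central a → ∀ x y → a * (x * y) ≈ x * (a * y)
  central-swap {a} ca x y = begin
    a * (x * y)   ≈⟨ *-assoc a x y ⟨
    (a * x) * y   ≈⟨ *-congʳ (ca x) ⟩
    (x * a) * y   ≈⟨ *-assoc x a y ⟩
    x * (a * y)   ∎

  central-interchange : ∀ {b} → Central b → ∀ a c d → (a * c) * (b * d) ≈ (a * b) * (c * d)
  central-interchange {b} cb a c d = begin
    (a * c) * (b * d)   ≈⟨ *-assoc a c (b * d) ⟩
    a * (c * (b * d))   ≈⟨ *-congˡ (central-swap cb c d) ⟨
    a * (b * (c * d))   ≈⟨ *-assoc a b (c * d) ⟨
    (a * b) * (c * d)   ∎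

  +-‿-interchange : ∀ a b c d → (a + b) - (c + d) ≈ (a - c) + (b - d)
  +-‿-interchange a b c d = begin
    (a + b) - (c + d)       ≈⟨ +-congˡ (⁻¹-∙-comm c d) ⟨
    (a + b) + (- c + - d)   ≈⟨ interchange a b (- c) (- d) ⟩
    (a - c) + (b - d)       ∎

  [a-b][c-d]≈[ac+bd]-[ad+bc] : ∀ a b c d → (a - b) * (c - d) ≈ (a * c + b * d) - (a * d + b * c)
  [a-b][c-d]≈[ac+bd]-[ad+bc] a b c d = begin
    (a - b) * (c - d)                     ≈⟨ [y-z]x≈yx-zx (c - d) a b ⟩
    a * (c - d) - b * (c - d)             ≈⟨ +-cong (x[y-z]≈xy-xz a c d) (-‿cong (x[y-z]≈xy-xz b c d)) ⟩
    (a * c - a * d) - (b * c - b * d)     ≈⟨ +-congˡ (⁻¹-anti-homo‿- (b * c) (b * d)) ⟩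
    (a * c - a * d) + (b * d - b * c)     ≈⟨ +-‿-interchange (a * c) (b * d) (a * d) (b * c) ⟨
    (a * c + b * d) - (a * d + b * c)     ∎

  [x,y]≈z⇒xy≈yx+z : ∀ {x y z} → [ x , y ] ≈ z → x * y ≈ y * x + z
  [x,y]≈z⇒xy≈yx+z {x} {y} {z} [x,y]≈z = begin
    x * y                     ≈⟨ //-rightDividesˡ (y * x) (x * y) ⟨
    (x * y - y * x) + y * x   ≈⟨ +-congʳ [x,y]≈z ⟩
    z + y * x                 ≈⟨ +-comm z (y * x) ⟩
    y * x + z                 ∎

  [x,y]≈z⇒yx≈xy-z : ∀ {x y z} → [ x , y ] ≈ z → y * x ≈ x * y - z
  [x,y]≈z⇒yx≈xy-z {x} {y} {z} [x,y]≈z = begin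
    y * x             ≈⟨ //-rightDividesʳ z (y * x) ⟨
    (y * x + z) - z   ≈⟨ +-congʳ ([x,y]≈z⇒xy≈yx+z [x,y]≈z) ⟨
    x * y - z         ∎

  xy≈yx+z⇒x[yw]≈y[xw]+zw : ∀ {x y z} → x * y ≈ y * x + z → ∀ w → x * (y * w) ≈ y * (x * w) + z * w
  xy≈yx+z⇒x[yw]≈y[xw]+zw {x} {y} {z} xy≈yx+z w = begin
    x * (y * w)               ≈⟨ *-assoc x y w ⟨
    (x * y) * w               ≈⟨ *-congʳ xy≈yx+z ⟩
    (y * x + z) * w           ≈⟨ distribʳ w (y * x) z ⟩
    (y * x) * w + z * w       ≈⟨ +-congʳ (*-assoc y x w) ⟩
    y * (x * w) + z * w       ∎

  module DyadicSemantics (h : Carrier) (2h≈1 : two * h ≈ 1#) where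
    ι : ℕ → Carrier
    ι n = n ×ᵣ 1#

    ι-central : ∀ n → Central (ι n)
    ι-central n x = begin
      ι n * x        ≈⟨ ×-assoc-* n 1# x ⟩
      n ×ᵣ (1# * x)  ≈⟨ ×-congʳ n (1#-central x) ⟩
      n ×ᵣ (x * 1#)  ≈⟨ ×-comm-* n x 1# ⟨
      x * ι n        ∎

    h-central : Central h
    h-central = central-inverse (+-central 1#-central 1#-central) 2h≈1

    ^-central : ∀ {a} → Central a → ∀ k → Central (a ^ k)
    ^-central ca zero = 1#-central
    ^-central ca (suc k) = *-central ca (^-central ca k)

    ι1≈1 : ι 1 ≈ 1#
    ι1≈1 = +-identityʳ 1#

    ι2≈two : ι 2 ≈ two
    ι2≈two = +-congˡ ι1≈1

    ι[2^j]*h^j≈1 : ∀ j → ι (2 ℕ.^ j) * h ^ j ≈ 1#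

    ι[2^j]*h^j≈1 zero = trans (*-identityʳ (ι 1)) ι1≈1
    ι[2^j]*h^j≈1 (suc j) = begin
      ι (2 ℕ.* 2 ℕ.^ j) * (h * h ^ j)     ≈⟨ *-congʳ (×1-homo-* 2 (2 ℕ.^ j)) ⟩
      (ι 2 * ι (2 ℕ.^ j)) * (h * h ^ j)   ≈⟨ central-interchange (ι-central (2 ℕ.^ j)) (ι 2) h (h ^ j) ⟨
      (ι 2 * h) * (ι (2 ℕ.^ j) * h ^ j)   ≈⟨ *-cong (*-congʳ ι2≈two) (ι[2^j]*h^j≈1 j) ⟩
      (two * h) * 1#                      ≈⟨ *-identityʳ (two * h) ⟩
      two * h                             ≈⟨ 2h≈1 ⟩
      1#                                  ∎

    ⟦_⟧ᵈ : Dyadic → Carrier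
    ⟦ p ⊖ q /2^ k ⟧ᵈ = (ι p - ι q) * h ^ k

    ⟦⟧ᵈ-central : ∀ d → Central ⟦ d ⟧ᵈ
    ⟦⟧ᵈ-central (p ⊖ q /2^ k) = *-central (+-central (ι-central p) (-‿central (ι-central q))) (^-central h-central k)

    ⟦p⊖0/2^k⟧ᵈ≈ι[p]*h^k : ∀ p k → ⟦ p ⊖ 0 /2^ k ⟧ᵈ ≈ ι p * h ^ k
    ⟦p⊖0/2^k⟧ᵈ≈ι[p]*h^k p k = *-congʳ (trans (+-congˡ ε⁻¹≈ε) (+-identityʳ (ι p)))

    ⟦⟧ᵈ-one : ⟦ Dyadic.one ⟧ᵈ ≈ 1#
    ⟦⟧ᵈ-one = trans (⟦p⊖0/2^k⟧ᵈ≈ι[p]*h^k 1 0) (trans (*-identityʳ (ι 1)) ι1≈1)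

    ⟦⟧ᵈ-two : ⟦ Dyadic.two ⟧ᵈ ≈ two
    ⟦⟧ᵈ-two = trans (⟦p⊖0/2^k⟧ᵈ≈ι[p]*h^k 2 0) (trans (*-identityʳ (ι 2)) ι2≈two)

    ⟦⟧ᵈ-half : ⟦ Dyadic.half ⟧ᵈ ≈ h
    ⟦⟧ᵈ-half = trans (⟦p⊖0/2^k⟧ᵈ≈ι[p]*h^k 1 1) (trans (*-cong ι1≈1 (*-identityʳ h)) (*-identityˡ h))

    ⟦⟧ᵈ-neg : ∀ d → ⟦ Dyadic.- d ⟧ᵈ ≈ - ⟦ d ⟧ᵈ
    ⟦⟧ᵈ-neg (p ⊖ q /2^ k) = begin
      (ι q - ι p) * h ^ k       ≈⟨ *-congʳ (⁻¹-anti-homo‿- (ι p) (ι q)) ⟨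
      - (ι p - ι q) * h ^ k     ≈⟨ -‿distribˡ-* (ι p - ι q) (h ^ k) ⟨
      - ((ι p - ι q) * h ^ k)   ∎

    ⟦⟧ᵈ-minus-one : ⟦ Dyadic.- Dyadic.one ⟧ᵈ ≈ - 1#
    ⟦⟧ᵈ-minus-one = trans (⟦⟧ᵈ-neg Dyadic.one) (-‿cong ⟦⟧ᵈ-one)

    ⟦⟧ᵈ-minus-two : ⟦ Dyadic.- Dyadic.two ⟧ᵈ ≈ - two
    ⟦⟧ᵈ-minus-two = trans (⟦⟧ᵈ-neg Dyadic.two) (-‿cong ⟦⟧ᵈ-two)

    ⟦⟧ᵈ-zero : ∀ d → Dyadic.IsZero d → ⟦ d ⟧ᵈ ≈ 0#
    ⟦⟧ᵈ-zero (p ⊖ p /2^ k) ≡.refl = trans (*-congʳ (-‿inverseʳ (ι p))) (zeroˡ (h ^ k))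

    ⟦⟧ᵈ-* : ∀ d e → ⟦ d Dyadic.* e ⟧ᵈ ≈ ⟦ d ⟧ᵈ * ⟦ e ⟧ᵈ
    ⟦⟧ᵈ-* (p ⊖ q /2^ k) (p′ ⊖ q′ /2^ k′) = begin
      (ι (p ℕ.* p′ ℕ.+ q ℕ.* q′) - ι (p ℕ.* q′ ℕ.+ q ℕ.* p′)) * h ^ (k ℕ.+ k′)
        ≈⟨ *-cong (+-cong (ι-sum-of-products p p′ q q′) (-‿cong (ι-sum-of-products p q′ q p′))) (^-homo-* h k k′) ⟩
      ((ι p * ι p′ + ι q * ι q′) - (ι p * ι q′ + ι q * ι p′)) * (h ^ k * h ^ k′)
        ≈⟨ *-congʳ ([a-b][c-d]≈[ac+bd]-[ad+bc] (ι p) (ι q) (ι p′) (ι q′)) ⟨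
      ((ι p - ι q) * (ι p′ - ι q′)) * (h ^ k * h ^ k′)
        ≈⟨ central-interchange (^-central h-central k) (ι p - ι q) (ι p′ - ι q′) (h ^ k′) ⟩
      ((ι p - ι q) * h ^ k) * ((ι p′ - ι q′) * h ^ k′) ∎
      where
        ι-sum-of-products : ∀ a b c d → ι (a ℕ.* b ℕ.+ c ℕ.* d) ≈ ι a * ι b + ι c * ι d
        ι-sum-of-products a b c d =
          trans (×-homo-+ 1# (a ℕ.* b) (c ℕ.* d)) (+-cong (×1-homo-* a b) (×1-homo-* c d))

    ⟦⟧ᵈ-rescale : ∀ {m} d → Dyadic.exponent d ≤ m → ⟦ Dyadic.rescale m d ⟧ᵈ ≈ ⟦ d ⟧ᵈ
    ⟦⟧ᵈ-rescale {m} (p ⊖ q /2^ k) k≤m = begin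
      (ι (p ℕ.* 2 ℕ.^ j) - ι (q ℕ.* 2 ℕ.^ j)) * h ^ m
        ≈⟨ *-cong (+-cong (×1-homo-* p (2 ℕ.^ j)) (-‿cong (×1-homo-* q (2 ℕ.^ j)))) (^-congʳ h (≡.sym (m+[n∸m]≡n k≤m))) ⟩
      (ι p * ι (2 ℕ.^ j) - ι q * ι (2 ℕ.^ j)) * h ^ (k ℕ.+ j)
        ≈⟨ *-cong ([y-z]x≈yx-zx (ι (2 ℕ.^ j)) (ι p) (ι q)) (sym (^-homo-* h k j)) ⟨
      ((ι p - ι q) * ι (2 ℕ.^ j)) * (h ^ k * h ^ j)
        ≈⟨ central-interchange (^-central h-central k) (ι p - ι q) (ι (2 ℕ.^ j)) (h ^ j) ⟩
      ((ι p - ι q) * h ^ k) * (ι (2 ℕ.^ j) * h ^ j)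
        ≈⟨ *-congˡ (ι[2^j]*h^j≈1 j) ⟩
      ((ι p - ι q) * h ^ k) * 1#
        ≈⟨ *-identityʳ ((ι p - ι q) * h ^ k) ⟩
      (ι p - ι q) * h ^ k ∎
      where j = m ∸ k

    ⟦⟧ᵈ-+-numerators : ∀ p q p′ q′ k → ⟦ p ℕ.+ p′ ⊖ q ℕ.+ q′ /2^ k ⟧ᵈ ≈ ⟦ p ⊖ q /2^ k ⟧ᵈ + ⟦ p′ ⊖ q′ /2^ k ⟧ᵈ
    ⟦⟧ᵈ-+-numerators p q p′ q′ k = begin
      (ι (p ℕ.+ p′) - ι (q ℕ.+ q′)) * h ^ k            ≈⟨ *-congʳ (+-cong (×-homo-+ 1# p p′) (-‿cong (×-homo-+ 1# q q′))) ⟩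
      ((ι p + ι p′) - (ι q + ι q′)) * h ^ k            ≈⟨ *-congʳ (+-‿-interchange (ι p) (ι p′) (ι q) (ι q′)) ⟩
      ((ι p - ι q) + (ι p′ - ι q′)) * h ^ k            ≈⟨ distribʳ (h ^ k) (ι p - ι q) (ι p′ - ι q′) ⟩
      (ι p - ι q) * h ^ k + (ι p′ - ι q′) * h ^ k      ∎

    ⟦⟧ᵈ-+ : ∀ d e → ⟦ d Dyadic.+ e ⟧ᵈ ≈ ⟦ d ⟧ᵈ + ⟦ e ⟧ᵈ
    ⟦⟧ᵈ-+ d@(p ⊖ q /2^ k) e@(p′ ⊖ q′ /2^ k′) = begin
      ⟦ d Dyadic.+ e ⟧ᵈ
        ≈⟨ ⟦⟧ᵈ-+-numerators (p ℕ.* a) (q ℕ.* a) (p′ ℕ.* b) (q′ ℕ.* b) m ⟩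
      ⟦ Dyadic.rescale m d ⟧ᵈ + ⟦ Dyadic.rescale m e ⟧ᵈ
        ≈⟨ +-cong (⟦⟧ᵈ-rescale d (m≤m⊔n k k′)) (⟦⟧ᵈ-rescale e (m≤n⊔m k k′)) ⟩
      ⟦ d ⟧ᵈ + ⟦ e ⟧ᵈ ∎
      where
        m = k ⊔ k′
        a = 2 ℕ.^ (m ∸ k)
        b = 2 ℕ.^ (m ∸ k′)

  module ExprSemantics (h : Carrier) {n} (ρ : Vec Carrier n) where
    ⟦_⟧ₑ : Expr n → Carrier
    ⟦ var x ⟧ₑ = lookup ρ x
    ⟦ 0ₑ ⟧ₑ = 0#
    ⟦ 1ₑ ⟧ₑ = 1#
    ⟦ ½ₑ ⟧ₑ = h
    ⟦ a +ₑ b ⟧ₑ = ⟦ a ⟧ₑ + ⟦ b ⟧ₑ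
    ⟦ a *ₑ b ⟧ₑ = ⟦ a ⟧ₑ * ⟦ b ⟧ₑ
    ⟦ -ₑ a ⟧ₑ = - ⟦ a ⟧ₑ

    exprRawRing : RawRing Level.0ℓ ℓ
    exprRawRing = record
      { Carrier = Expr n
      ; _≈_ = _≈_ on ⟦_⟧ₑ
      ; _+_ = _+ₑ_
      ; _*_ = _*ₑ_
      ; -_ = -ₑ_
      ; 0# = 0ₑ
      ; 1# = 1ₑ
      }

    ⟦⟧ₑ-isRingMonomorphism : IsRingMonomorphism exprRawRing rawRing ⟦_⟧ₑ
    ⟦⟧ₑ-isRingMonomorphism = record
      { isRingHomomorphism = record
        { isSemiringHomomorphism = record
          { isNearSemiringHomomorphism = record
            { +-isMonoidHomomorphism = record
              { isMagmaHomomorphism = record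
                { isRelHomomorphism = record { cong = id }
                ; homo = λ _ _ → refl
                }
              ; ε-homo = refl
              }
            ; *-homo = λ _ _ → refl
            }
          ; 1#-homo = refl
          }
        ; -‿homo = λ _ → refl
        }
      ; injective = id
      }

    -- The ring laws hold because ⟦_⟧ₑ is injective by construction. The definitions of InRing
    -- instantiated in exprRing are expressions whose ⟦_⟧ₑ reduces to the same definitions in R.
    exprRing : Ring Level.0ℓ ℓ
    exprRing = record { isRing = RingMonomorphism.isRing ⟦⟧ₑ-isRingMonomorphism isRing }

  module PolySemantics (h : Carrier) (2h≈1 : two * h ≈ 1#) {n} (ρ : Vec Carrier n) where
    open DyadicSemantics h 2h≈1
    open ExprSemantics h ρ public
    open Polynomials n

    ⟦_⟧ʷ : Word → Carrier
    ⟦ [] ⟧ʷ = 1#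
    ⟦ g ∷ w ⟧ʷ = lookup ρ g * ⟦ w ⟧ʷ

    ⟦_⟧ᵗ : Term → Carrier
    ⟦ d , w ⟧ᵗ = ⟦ d ⟧ᵈ * ⟦ w ⟧ʷ

    ⟦_⟧ : Poly → Carrier
    ⟦ [] ⟧ = 0#
    ⟦ t ∷ p ⟧ = ⟦ t ⟧ᵗ + ⟦ p ⟧

    ⟨⟩-sound : ∀ w → ⟦ ⟨ w ⟩ ⟧ ≈ ⟦ w ⟧ʷ
    ⟨⟩-sound w = trans (+-identityʳ _) (trans (*-congʳ ⟦⟧ᵈ-one) (*-identityˡ ⟦ w ⟧ʷ))

    ⟦⟧ᵗ-+ : ∀ d e w → ⟦ d Dyadic.+ e , w ⟧ᵗ ≈ ⟦ d , w ⟧ᵗ + ⟦ e , w ⟧ᵗ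
    ⟦⟧ᵗ-+ d e w = trans (*-congʳ (⟦⟧ᵈ-+ d e)) (distribʳ ⟦ w ⟧ʷ ⟦ d ⟧ᵈ ⟦ e ⟧ᵈ)

    insert-homo : ∀ t p → ⟦ insert t p ⟧ ≈ ⟦ t ⟧ᵗ + ⟦ p ⟧
    insert-homo t [] = refl
    insert-homo (d , w) ((e , v) ∷ p) with w ≟ʷ v | Dyadic.isZero? (d Dyadic.+ e)
    ... | yes ≡.refl | yes d+e≡0 = begin
      ⟦ p ⟧                                ≈⟨ +-identityˡ ⟦ p ⟧ ⟨
      0# + ⟦ p ⟧                           ≈⟨ +-congʳ (trans (*-congʳ (⟦⟧ᵈ-zero (d Dyadic.+ e) d+e≡0)) (zeroˡ ⟦ w ⟧ʷ)) ⟨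
      ⟦ d Dyadic.+ e , w ⟧ᵗ + ⟦ p ⟧        ≈⟨ +-congʳ (⟦⟧ᵗ-+ d e w) ⟩
      (⟦ d , w ⟧ᵗ + ⟦ e , w ⟧ᵗ) + ⟦ p ⟧    ≈⟨ +-assoc ⟦ d , w ⟧ᵗ ⟦ e , w ⟧ᵗ ⟦ p ⟧ ⟩
      ⟦ d , w ⟧ᵗ + (⟦ e , w ⟧ᵗ + ⟦ p ⟧)    ∎
    ... | yes ≡.refl | no _ = trans (+-congʳ (⟦⟧ᵗ-+ d e w)) (+-assoc ⟦ d , w ⟧ᵗ ⟦ e , w ⟧ᵗ ⟦ p ⟧)
    ... | no _ | _ = begin
      ⟦ e , v ⟧ᵗ + ⟦ insert (d , w) p ⟧    ≈⟨ +-congˡ (insert-homo (d , w) p) ⟩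
      ⟦ e , v ⟧ᵗ + (⟦ d , w ⟧ᵗ + ⟦ p ⟧)    ≈⟨ x∙yz≈y∙xz ⟦ e , v ⟧ᵗ ⟦ d , w ⟧ᵗ ⟦ p ⟧ ⟩
      ⟦ d , w ⟧ᵗ + (⟦ e , v ⟧ᵗ + ⟦ p ⟧)    ∎

    ⊕-homo : ∀ p q → ⟦ p ⊕ q ⟧ ≈ ⟦ p ⟧ + ⟦ q ⟧
    ⊕-homo [] q = sym (+-identityˡ ⟦ q ⟧)
    ⊕-homo (t ∷ p) q = begin
      ⟦ insert t (p ⊕ q) ⟧        ≈⟨ insert-homo t (p ⊕ q) ⟩
      ⟦ t ⟧ᵗ + ⟦ p ⊕ q ⟧          ≈⟨ +-congˡ (⊕-homo p q) ⟩
      ⟦ t ⟧ᵗ + (⟦ p ⟧ + ⟦ q ⟧)    ≈⟨ +-assoc ⟦ t ⟧ᵗ ⟦ p ⟧ ⟦ q ⟧ ⟨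
      (⟦ t ⟧ᵗ + ⟦ p ⟧) + ⟦ q ⟧    ∎

    ⊙-homo : ∀ d p → ⟦ d ⊙ p ⟧ ≈ ⟦ d ⟧ᵈ * ⟦ p ⟧
    ⊙-homo d [] = sym (zeroʳ ⟦ d ⟧ᵈ)
    ⊙-homo d ((e , w) ∷ p) = begin
      ⟦ d Dyadic.* e ⟧ᵈ * ⟦ w ⟧ʷ + ⟦ d ⊙ p ⟧      ≈⟨ +-cong (*-congʳ (⟦⟧ᵈ-* d e)) (⊙-homo d p) ⟩
      (⟦ d ⟧ᵈ * ⟦ e ⟧ᵈ) * ⟦ w ⟧ʷ + ⟦ d ⟧ᵈ * ⟦ p ⟧  ≈⟨ +-congʳ (*-assoc ⟦ d ⟧ᵈ ⟦ e ⟧ᵈ ⟦ w ⟧ʷ) ⟩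
      ⟦ d ⟧ᵈ * ⟦ e , w ⟧ᵗ + ⟦ d ⟧ᵈ * ⟦ p ⟧         ≈⟨ distribˡ ⟦ d ⟧ᵈ ⟦ e , w ⟧ᵗ ⟦ p ⟧ ⟨
      ⟦ d ⟧ᵈ * (⟦ e , w ⟧ᵗ + ⟦ p ⟧)                ∎

    ◃-homo : ∀ g p → ⟦ g ◃ p ⟧ ≈ lookup ρ g * ⟦ p ⟧
    ◃-homo g [] = sym (zeroʳ (lookup ρ g))
    ◃-homo g ((d , w) ∷ p) = begin
      ⟦ d ⟧ᵈ * (lookup ρ g * ⟦ w ⟧ʷ) + ⟦ g ◃ p ⟧          ≈⟨ +-cong (central-swap (⟦⟧ᵈ-central d) (lookup ρ g) ⟦ w ⟧ʷ) (◃-homo g p) ⟩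
      lookup ρ g * ⟦ d , w ⟧ᵗ + lookup ρ g * ⟦ p ⟧        ≈⟨ distribˡ (lookup ρ g) ⟦ d , w ⟧ᵗ ⟦ p ⟧ ⟨
      lookup ρ g * (⟦ d , w ⟧ᵗ + ⟦ p ⟧)                   ∎

    linear-homo : ∀ {f x} → (∀ w → ⟦ f w ⟧ ≈ x * ⟦ w ⟧ʷ) → ∀ p → ⟦ linear f p ⟧ ≈ x * ⟦ p ⟧
    linear-homo {f} {x} f≈x* [] = sym (zeroʳ x)
    linear-homo {f} {x} f≈x* ((d , w) ∷ p) = begin
      ⟦ d ⊙ f w ⊕ linear f p ⟧                 ≈⟨ ⊕-homo (d ⊙ f w) (linear f p) ⟩
      ⟦ d ⊙ f w ⟧ + ⟦ linear f p ⟧             ≈⟨ +-cong (⊙-homo d (f w)) (linear-homo f≈x* p) ⟩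
      ⟦ d ⟧ᵈ * ⟦ f w ⟧ + x * ⟦ p ⟧             ≈⟨ +-congʳ (*-congˡ (f≈x* w)) ⟩
      ⟦ d ⟧ᵈ * (x * ⟦ w ⟧ʷ) + x * ⟦ p ⟧        ≈⟨ +-congʳ (central-swap (⟦⟧ᵈ-central d) x ⟦ w ⟧ʷ) ⟩
      x * ⟦ d , w ⟧ᵗ + x * ⟦ p ⟧               ≈⟨ distribˡ x ⟦ d , w ⟧ᵗ ⟦ p ⟧ ⟨
      x * (⟦ d , w ⟧ᵗ + ⟦ p ⟧)                 ∎

    module NormaliseSemantics (_·_ : Fin n → Word → Poly)
                              (·-sound : ∀ g w → ⟦ g · w ⟧ ≈ lookup ρ g * ⟦ w ⟧ʷ) where
      open Normalise _·_

      ⊗ʷ-homo : ∀ w p → ⟦ w ⊗ʷ p ⟧ ≈ ⟦ w ⟧ʷ * ⟦ p ⟧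
      ⊗ʷ-homo [] p = sym (*-identityˡ ⟦ p ⟧)
      ⊗ʷ-homo (g ∷ w) p = begin
        ⟦ linear (g ·_) (w ⊗ʷ p) ⟧       ≈⟨ linear-homo (·-sound g) (w ⊗ʷ p) ⟩
        lookup ρ g * ⟦ w ⊗ʷ p ⟧          ≈⟨ *-congˡ (⊗ʷ-homo w p) ⟩
        lookup ρ g * (⟦ w ⟧ʷ * ⟦ p ⟧)    ≈⟨ *-assoc (lookup ρ g) ⟦ w ⟧ʷ ⟦ p ⟧ ⟨
        ⟦ g ∷ w ⟧ʷ * ⟦ p ⟧               ∎

      ⊗-homo : ∀ p q → ⟦ p ⊗ q ⟧ ≈ ⟦ p ⟧ * ⟦ q ⟧
      ⊗-homo [] q = sym (zeroˡ ⟦ q ⟧)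
      ⊗-homo ((d , w) ∷ p) q = begin
        ⟦ d ⊙ w ⊗ʷ q ⊕ p ⊗ q ⟧                    ≈⟨ ⊕-homo (d ⊙ w ⊗ʷ q) (p ⊗ q) ⟩
        ⟦ d ⊙ w ⊗ʷ q ⟧ + ⟦ p ⊗ q ⟧                ≈⟨ +-cong (⊙-homo d (w ⊗ʷ q)) (⊗-homo p q) ⟩
        ⟦ d ⟧ᵈ * ⟦ w ⊗ʷ q ⟧ + ⟦ p ⟧ * ⟦ q ⟧        ≈⟨ +-congʳ (*-congˡ (⊗ʷ-homo w q)) ⟩
        ⟦ d ⟧ᵈ * (⟦ w ⟧ʷ * ⟦ q ⟧) + ⟦ p ⟧ * ⟦ q ⟧  ≈⟨ +-congʳ (*-assoc ⟦ d ⟧ᵈ ⟦ w ⟧ʷ ⟦ q ⟧) ⟨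
        ⟦ d , w ⟧ᵗ * ⟦ q ⟧ + ⟦ p ⟧ * ⟦ q ⟧         ≈⟨ distribʳ ⟦ q ⟧ ⟦ d , w ⟧ᵗ ⟦ p ⟧ ⟨
        (⟦ d , w ⟧ᵗ + ⟦ p ⟧) * ⟦ q ⟧               ∎

      nf-sound : ∀ e → ⟦ nf e ⟧ ≈ ⟦ e ⟧ₑ
      nf-sound (var g) = trans (⟨⟩-sound (g ∷ [])) (*-identityʳ (lookup ρ g))
      nf-sound 0ₑ = refl
      nf-sound 1ₑ = ⟨⟩-sound []
      nf-sound ½ₑ = trans (+-identityʳ _) (trans (*-identityʳ ⟦ Dyadic.half ⟧ᵈ) ⟦⟧ᵈ-half)
      nf-sound (a +ₑ b) = trans (⊕-homo (nf a) (nf b)) (+-cong (nf-sound a) (nf-sound b))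
      nf-sound (a *ₑ b) = trans (⊗-homo (nf a) (nf b)) (*-cong (nf-sound a) (nf-sound b))
      nf-sound (-ₑ a) = begin
        ⟦ Dyadic.- Dyadic.one ⊙ nf a ⟧        ≈⟨ ⊙-homo (Dyadic.- Dyadic.one) (nf a) ⟩
        ⟦ Dyadic.- Dyadic.one ⟧ᵈ * ⟦ nf a ⟧   ≈⟨ *-cong ⟦⟧ᵈ-minus-one (nf-sound a) ⟩
        - 1# * ⟦ a ⟧ₑ                          ≈⟨ -1*x≈-x ⟦ a ⟧ₑ ⟩
        - ⟦ a ⟧ₑ                               ∎

      nf[x-y]≡[]⇒x≈y : ∀ x y → nf (x +ₑ -ₑ y) ≡.≡ [] → ⟦ x ⟧ₑ ≈ ⟦ y ⟧ₑ
      nf[x-y]≡[]⇒x≈y x y nf≡[] =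
        x∙y⁻¹≈ε⇒x≈y ⟦ x ⟧ₑ ⟦ y ⟧ₑ (trans (sym (nf-sound (x +ₑ -ₑ y))) (reflexive (≡.cong ⟦_⟧ nf≡[])))

  module Sl2Semantics {i h E F H : Carrier} (sl2 : InRing.Sl2Data R i h E F H) where
    open InRing.Sl2Data sl2
    open DyadicSemantics h h-half

    ρ : Vec Carrier 4
    ρ = i ∷ F ∷ H ∷ E ∷ []

    open PolySemantics h h-half ρ public
    open Polynomials 4
    open Sl2

    HF≈FH+[-2]F : H * F ≈ F * H + (- two) * F
    HF≈FH+[-2]F = trans ([x,y]≈z⇒xy≈yx+z HF) (+-congˡ (-‿distribˡ-* two F))

    EH≈HE+[-2]E : E * H ≈ H * E + (- two) * E
    EH≈HE+[-2]E = trans ([x,y]≈z⇒yx≈xy-z HE) (+-congˡ (-‿distribˡ-* two E))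

    𝐢◃-sound : ∀ p {x y} → ⟦ p ⟧ ≈ x * y → ⟦ 𝐢 ◃ p ⟧ ≈ x * (i * y)
    𝐢◃-sound p {x} {y} p≈xy = trans (◃-homo 𝐢 p) (trans (*-congˡ p≈xy) (central-swap i-central x y))

    𝐢·-sound : ∀ w → ⟦ 𝐢· w ⟧ ≈ i * ⟦ w ⟧ʷ
    𝐢·-sound (𝐢 ∷ w) = begin
      ⟦ Dyadic.- Dyadic.one ⊙ ⟨ w ⟩ ⟧        ≈⟨ ⊙-homo (Dyadic.- Dyadic.one) ⟨ w ⟩ ⟩
      ⟦ Dyadic.- Dyadic.one ⟧ᵈ * ⟦ ⟨ w ⟩ ⟧   ≈⟨ *-cong ⟦⟧ᵈ-minus-one (⟨⟩-sound w) ⟩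
      - 1# * ⟦ w ⟧ʷ                           ≈⟨ *-congʳ i² ⟨
      (i * i) * ⟦ w ⟧ʷ                        ≈⟨ *-assoc i i ⟦ w ⟧ʷ ⟩
      i * (i * ⟦ w ⟧ʷ)                        ∎
    𝐢·-sound [] = ⟨⟩-sound (𝐢 ∷ [])
    𝐢·-sound (𝐅 ∷ w) = ⟨⟩-sound (𝐢 ∷ 𝐅 ∷ w)
    𝐢·-sound (𝐇 ∷ w) = ⟨⟩-sound (𝐢 ∷ 𝐇 ∷ w)
    𝐢·-sound (𝐄 ∷ w) = ⟨⟩-sound (𝐢 ∷ 𝐄 ∷ w)

    𝐅·-sound : ∀ w → ⟦ 𝐅· w ⟧ ≈ F * ⟦ w ⟧ʷ
    𝐅·-sound (𝐢 ∷ w) = 𝐢◃-sound (𝐅· w) (𝐅·-sound w)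
    𝐅·-sound [] = ⟨⟩-sound (𝐅 ∷ [])
    𝐅·-sound (𝐅 ∷ w) = ⟨⟩-sound (𝐅 ∷ 𝐅 ∷ w)
    𝐅·-sound (𝐇 ∷ w) = ⟨⟩-sound (𝐅 ∷ 𝐇 ∷ w)
    𝐅·-sound (𝐄 ∷ w) = ⟨⟩-sound (𝐅 ∷ 𝐄 ∷ w)

    𝐇·-sound : ∀ w → ⟦ 𝐇· w ⟧ ≈ H * ⟦ w ⟧ʷ
    𝐇·-sound (𝐢 ∷ w) = 𝐢◃-sound (𝐇· w) (𝐇·-sound w)
    𝐇·-sound (𝐅 ∷ w) = begin
      ⟦ 𝐅 ◃ 𝐇· w ⊕ Dyadic.- Dyadic.two ⊙ ⟨ 𝐅 ∷ w ⟩ ⟧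
        ≈⟨ ⊕-homo (𝐅 ◃ 𝐇· w) (Dyadic.- Dyadic.two ⊙ ⟨ 𝐅 ∷ w ⟩) ⟩
      ⟦ 𝐅 ◃ 𝐇· w ⟧ + ⟦ Dyadic.- Dyadic.two ⊙ ⟨ 𝐅 ∷ w ⟩ ⟧
        ≈⟨ +-cong (trans (◃-homo 𝐅 (𝐇· w)) (*-congˡ (𝐇·-sound w)))
                  (trans (⊙-homo (Dyadic.- Dyadic.two) ⟨ 𝐅 ∷ w ⟩) (*-cong ⟦⟧ᵈ-minus-two (⟨⟩-sound (𝐅 ∷ w)))) ⟩
      F * (H * ⟦ w ⟧ʷ) + (- two) * (F * ⟦ w ⟧ʷ)
        ≈⟨ +-congˡ (*-assoc (- two) F ⟦ w ⟧ʷ) ⟨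
      F * (H * ⟦ w ⟧ʷ) + ((- two) * F) * ⟦ w ⟧ʷ
        ≈⟨ xy≈yx+z⇒x[yw]≈y[xw]+zw HF≈FH+[-2]F ⟦ w ⟧ʷ ⟨
      H * (F * ⟦ w ⟧ʷ) ∎
    𝐇·-sound [] = ⟨⟩-sound (𝐇 ∷ [])
    𝐇·-sound (𝐇 ∷ w) = ⟨⟩-sound (𝐇 ∷ 𝐇 ∷ w)
    𝐇·-sound (𝐄 ∷ w) = ⟨⟩-sound (𝐇 ∷ 𝐄 ∷ w)

    𝐄·-sound : ∀ w → ⟦ 𝐄· w ⟧ ≈ E * ⟦ w ⟧ʷ
    𝐄·-sound (𝐢 ∷ w) = 𝐢◃-sound (𝐄· w) (𝐄·-sound w)
    𝐄·-sound (𝐅 ∷ w) = begin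
      ⟦ 𝐅 ◃ 𝐄· w ⊕ 𝐇· w ⟧             ≈⟨ ⊕-homo (𝐅 ◃ 𝐄· w) (𝐇· w) ⟩
      ⟦ 𝐅 ◃ 𝐄· w ⟧ + ⟦ 𝐇· w ⟧         ≈⟨ +-cong (trans (◃-homo 𝐅 (𝐄· w)) (*-congˡ (𝐄·-sound w))) (𝐇·-sound w) ⟩
      F * (E * ⟦ w ⟧ʷ) + H * ⟦ w ⟧ʷ   ≈⟨ xy≈yx+z⇒x[yw]≈y[xw]+zw ([x,y]≈z⇒xy≈yx+z EF) ⟦ w ⟧ʷ ⟨
      E * (F * ⟦ w ⟧ʷ)                ∎
    𝐄·-sound (𝐇 ∷ w) = begin
      ⟦ linear 𝐇·_ (𝐄· w) ⊕ Dyadic.- Dyadic.two ⊙ 𝐄· w ⟧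
        ≈⟨ ⊕-homo (linear 𝐇·_ (𝐄· w)) (Dyadic.- Dyadic.two ⊙ 𝐄· w) ⟩
      ⟦ linear 𝐇·_ (𝐄· w) ⟧ + ⟦ Dyadic.- Dyadic.two ⊙ 𝐄· w ⟧
        ≈⟨ +-cong (linear-homo 𝐇·-sound (𝐄· w)) (trans (⊙-homo (Dyadic.- Dyadic.two) (𝐄· w)) (*-congʳ ⟦⟧ᵈ-minus-two)) ⟩
      H * ⟦ 𝐄· w ⟧ + (- two) * ⟦ 𝐄· w ⟧
        ≈⟨ +-cong (*-congˡ (𝐄·-sound w)) (*-congˡ (𝐄·-sound w)) ⟩
      H * (E * ⟦ w ⟧ʷ) + (- two) * (E * ⟦ w ⟧ʷ)
        ≈⟨ +-congˡ (*-assoc (- two) E ⟦ w ⟧ʷ) ⟨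
      H * (E * ⟦ w ⟧ʷ) + ((- two) * E) * ⟦ w ⟧ʷ
        ≈⟨ xy≈yx+z⇒x[yw]≈y[xw]+zw EH≈HE+[-2]E ⟦ w ⟧ʷ ⟨
      E * (H * ⟦ w ⟧ʷ) ∎
    𝐄·-sound [] = ⟨⟩-sound (𝐄 ∷ [])
    𝐄·-sound (𝐄 ∷ w) = ⟨⟩-sound (𝐄 ∷ 𝐄 ∷ w)

    ·-sound : ∀ g w → ⟦ g · w ⟧ ≈ lookup ρ g * ⟦ w ⟧ʷ
    ·-sound 𝐢 = 𝐢·-sound
    ·-sound 𝐅 = 𝐅·-sound
    ·-sound 𝐇 = 𝐇·-sound
    ·-sound 𝐄 = 𝐄·-sound

    open NormaliseSemantics _·_ ·-sound public

theorem1p4 : ∀ {c ℓ} (R : Ring c ℓ) (i h E F H : Ring.Carrier R) →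
    InRing.Sl2Data R i h E F H → InRing.Sharp.Claim R i h E F H
theorem1p4 R i h E F H sl2 =
  nf[x-y]≡[]⇒x≈y ΩA ΩB ≡.refl , nf[x-y]≡[]⇒x≈y ΩB ΩC ≡.refl , nf[x-y]≡[]⇒x≈y ΩC target ≡.refl
  where
    open Semantics.Sl2Semantics R sl2
    open InRing.Sharp exprRing (var 𝐢) ½ₑ (var 𝐄) (var 𝐅) (var 𝐇)
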